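{- Let $P$ be the Petersen graph and $X\subseteq V(P)$. Then $X$ is an outer mutual-visibility set of $P$ if and only if $X$ is an independent set of $P$.
   Context: For a graph $G$ and $X\subseteq V(G)$, two vertices $x,y$ are $X$-visible if there is a shortest $x,y$-path in $G$ with no internal vertex in $X$. $X$ is an outer mutual-visibility set if any two vertices of $X$ are $X$-visible and any $x\in X$, $y\in V(G)\setminus X$ are $X$-visible. -}

module Defs where

open import Data.Nat using (ℕ; zero; suc; _≤_)
open import Data.Fin using (Fin)
open import Data.Fin using (#_)
open import Data.Fin.Subset using (Subset; _∈_; _∉_)
open import Data.List using (List; []; _∷_)
import Data.List.Membership.Propositional as LM
open import Data.Product using (Σ; _×_; _,_)
open import Data.Sum using (_⊎_)
open import Relation.Nullary using (¬_)
open import Relation.Binary.PropositionalEquality using (_≡_)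

record Graph (n : ℕ) : Set₁ where
  field
    Adj : Fin n → Fin n → Set

module _ {n : ℕ} (G : Graph n) where
  open Graph G

  data Walk (x : Fin n) : Fin n → Set where
    []  : Walk x x
    _∷_ : ∀ {y z} → Adj x y → Walk y z → Walk x z

  length : ∀ {x y} → Walk x y → ℕ
  length []      = zero
  length (_ ∷ w) = suc (length w)

  internal : ∀ {x y} → Walk x y → List (Fin n)
  internal []                          = []
  internal (_ ∷ [])                    = []
  internal (_∷_ {y} _ (e ∷ w))         = y ∷ internal (e ∷ w)

  -- a shortest x,y-path: an x,y-walk no longer than any other x,y-walk
  -- (a shortest walk is automatically a path)
  IsShortest : ∀ {x y} → Walk x y → Set
  IsShortest {x} {y} w = (w' : Walk x y) → length w ≤ length w'

  Visible : Subset n → Fin n → Fin n → Set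
  Visible X x y =
    Σ (Walk x y) λ w → IsShortest w × ((v : Fin n) → v LM.∈ internal w → v ∉ X)

  IsOuterMutualVisibility : Subset n → Set
  IsOuterMutualVisibility X =
    ((x y : Fin n) → x ∈ X → y ∈ X → Visible X x y) ×
    ((x y : Fin n) → x ∈ X → y ∉ X → Visible X x y)

  IsIndependent : Subset n → Set
  IsIndependent X = (x y : Fin n) → x ∈ X → y ∈ X → ¬ Adj x y

-- The Petersen graph: outer 5-cycle 0-1-2-3-4-0, spokes i-(i+5),
-- inner pentagram 5-7-9-6-8-5.
petersenEdges : List (Fin 10 × Fin 10)
petersenEdges =
  (# 0 , # 1) ∷ (# 1 , # 2) ∷ (# 2 , # 3) ∷ (# 3 , # 4) ∷ (# 4 , # 0) ∷
  (# 0 , # 5) ∷ (# 1 , # 6) ∷ (# 2 , # 7) ∷ (# 3 , # 8) ∷ (# 4 , # 9) ∷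
  (# 5 , # 7) ∷ (# 7 , # 9) ∷ (# 9 , # 6) ∷ (# 6 , # 8) ∷ (# 8 , # 5) ∷ []

Petersen : Graph 10
Petersen = record
  { Adj = λ x y → ((x , y) LM.∈ petersenEdges) ⊎ ((y , x) LM.∈ petersenEdges) }

-- In the Petersen graph two distinct non-adjacent vertices have exactly one
-- common neighbour, and no two adjacent vertices have any.  If X is
-- independent, a shortest path between x ∈ X and any y has length at most 2,
-- and its only possible internal vertex is a neighbour of x, hence not in X.
-- Conversely, if x, y ∈ X are adjacent, pick another neighbour z of x: then
-- y and z are at distance 2 and x is their unique common neighbour, so every
-- shortest y,z-path passes through x ∈ X, and y is not X-visible from z.
module Submission where

open import Defs
open import Data.Empty using (⊥-elim)
open import Data.Fin using (Fin; _≟_)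
open import Data.Fin.Properties using (all?; any?)
open import Data.Fin.Subset using (Subset; _∈_; _∉_)
open import Data.Fin.Subset.Properties using () renaming (_∈?_ to _∈ₛ?_)
open import Data.List using ([]; _∷_)
open import Data.List.Relation.Unary.Any using (here)
import Data.List.Membership.Propositional as List
open import Data.Product.Properties using (≡-dec)
open import Data.List.Membership.DecPropositional (≡-dec (_≟_ {10}) (_≟_ {10}))
  using () renaming (_∈?_ to _∈ₗ?_)
open import Data.Nat using (ℕ; _≤_; z≤n; s≤s)
open import Data.Product using (_×_; _,_; ∃)
open import Data.Sum using (inj₁; inj₂; [_,_]′)
open import Function using (_∘_)
open import Relation.Binary.Definitions using (Symmetric; Decidable)
open import Relation.Binary.PropositionalEquality using (_≡_; _≢_; refl; sym; subst)
open import Relation.Nullary using (¬_; yes; no)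
open import Relation.Nullary.Decidable using (¬?; _×-dec_; _⊎-dec_; _→-dec_; toWitness)

module _ {n : ℕ} (G : Graph n) where
  open Graph G

  NoLeaves : Set
  NoLeaves = ∀ {x y} → Adj x y → ∃ λ z → Adj x z × z ≢ y

  TriangleFree : Set
  TriangleFree = ∀ {x y z} → Adj x y → Adj y z → ¬ Adj x z

  DiameterAtMostTwo : Set
  DiameterAtMostTwo = ∀ {x y} → x ≢ y → ¬ Adj x y → ∃ λ c → Adj x c × Adj c y

  AtMostOneCommonNeighbour : Set
  AtMostOneCommonNeighbour =
    ∀ {x y c d} → x ≢ y → Adj x c → Adj c y → Adj x d → Adj d y → c ≡ d

  length≥1 : ∀ {x y} → x ≢ y → (w : Walk G x y) → 1 ≤ length G w
  length≥1 x≢y []      = ⊥-elim (x≢y refl)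
  length≥1 x≢y (_ ∷ _) = s≤s z≤n

  length≥2 : ∀ {x y} → x ≢ y → ¬ Adj x y → (w : Walk G x y) → 2 ≤ length G w
  length≥2 x≢y x≁y []            = ⊥-elim (x≢y refl)
  length≥2 x≢y x≁y (e ∷ [])      = ⊥-elim (x≁y e)
  length≥2 x≢y x≁y (_ ∷ (_ ∷ _)) = s≤s (s≤s z≤n)

  midpoint-of-length≤2 : ∀ {x y} → x ≢ y → ¬ Adj x y → (w : Walk G x y) →
    length G w ≤ 2 → ∃ λ m → Adj x m × Adj m y × m List.∈ internal G w
  midpoint-of-length≤2 x≢y x≁y []                    _ = ⊥-elim (x≢y refl)
  midpoint-of-length≤2 x≢y x≁y (e ∷ [])              _ = ⊥-elim (x≁y e)
  midpoint-of-length≤2 x≢y x≁y (_∷_ {m} e (f ∷ []))  _ = m , e , f , here refl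
  midpoint-of-length≤2 x≢y x≁y (_ ∷ (_ ∷ (_ ∷ _))) (s≤s (s≤s ()))

  outerMutualVisibility⇒visible : ∀ {X} → IsOuterMutualVisibility G X →
    ∀ {x} → x ∈ X → ∀ y → Visible G X x y
  outerMutualVisibility⇒visible {X} (inside , outside) {x} x∈X y with y ∈ₛ? X
  ... | yes y∈X = inside x y x∈X y∈X
  ... | no  y∉X = outside x y x∈X y∉X

  outerMutualVisibility⇒independent : Symmetric Adj → NoLeaves → TriangleFree →
    AtMostOneCommonNeighbour →
    ∀ X → IsOuterMutualVisibility G X → IsIndependent G X
  outerMutualVisibility⇒independent adj-sym no-leaves triangle-free unique X omv x y x∈X y∈X x~y =
    let z , x~z , z≢y = no-leaves x~y
        y≢z = z≢y ∘ sym
        w , shortest , avoids-X = outerMutualVisibility⇒visible omv y∈X z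
        m , y~m , m~z , m∈w =
          midpoint-of-length≤2 y≢z (triangle-free y~x x~z) w (shortest (y~x ∷ (x~z ∷ [])))
        m≡x = unique y≢z y~m m~z y~x x~z
    in avoids-X x (subst (List._∈ internal G w) m≡x m∈w) x∈X
    where
    y~x : Adj y x
    y~x = adj-sym x~y

  independent⇒visible : Decidable Adj → DiameterAtMostTwo →
    ∀ {X} → IsIndependent G X → ∀ {x} → x ∈ X → ∀ y → Visible G X x y
  independent⇒visible adj? diam {X} independent {x} x∈X y with x ≟ y
  ... | yes refl = [] , (λ _ → z≤n) , λ _ ()
  ... | no x≢y with adj? x y
  ...   | yes x~y = (x~y ∷ []) , length≥1 x≢y , λ _ ()
  ...   | no x≁y with diam x≢y x≁y
  ...     | c , x~c , c~y = (x~c ∷ (c~y ∷ [])) , length≥2 x≢y x≁y , c∉X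
    where
    c∉X : (v : Fin n) → v List.∈ c ∷ [] → v ∉ X
    c∉X v (here refl) c∈X = independent x c x∈X c∈X x~c

  independent⇒outerMutualVisibility : Decidable Adj → DiameterAtMostTwo →
    ∀ X → IsIndependent G X → IsOuterMutualVisibility G X
  independent⇒outerMutualVisibility adj? diam X independent =
    (λ x y x∈X _ → visible x∈X y) , (λ x y x∈X _ → visible x∈X y)
    where
    visible : ∀ {x} → x ∈ X → ∀ y → Visible G X x y
    visible = independent⇒visible adj? diam independent

open Graph Petersen using (Adj)

petersen-adj? : Decidable Adj
petersen-adj? x y = ((x , y) ∈ₗ? petersenEdges) ⊎-dec ((y , x) ∈ₗ? petersenEdges)

petersen-sym : Symmetric Adj
petersen-sym = [ inj₂ , inj₁ ]′

petersen-noLeaves : NoLeaves Petersen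
petersen-noLeaves {x} {y} = toWitness
  {a? = all? λ x → all? λ y → petersen-adj? x y →-dec
          any? λ z → petersen-adj? x z ×-dec ¬? (z ≟ y)} _ x y

petersen-triangleFree : TriangleFree Petersen
petersen-triangleFree {x} {y} {z} = toWitness
  {a? = all? λ x → all? λ y → all? λ z → petersen-adj? x y →-dec
          (petersen-adj? y z →-dec ¬? (petersen-adj? x z))} _ x y z

petersen-diameterAtMostTwo : DiameterAtMostTwo Petersen
petersen-diameterAtMostTwo {x} {y} = toWitness
  {a? = all? λ x → all? λ y → ¬? (x ≟ y) →-dec (¬? (petersen-adj? x y) →-dec
          any? λ c → petersen-adj? x c ×-dec petersen-adj? c y)} _ x y

petersen-atMostOneCommonNeighbour : AtMostOneCommonNeighbour Petersen
petersen-atMostOneCommonNeighbour {x} {y} {c} {d} x≢y x~c c~y x~d d~y = toWitness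
  {a? = all? λ x → all? λ c → petersen-adj? x c →-dec all? λ y → petersen-adj? c y →-dec
          (¬? (x ≟ y) →-dec all? λ d → petersen-adj? x d →-dec (petersen-adj? d y →-dec (c ≟ d)))}
  _ x c x~c y c~y x≢y d x~d d~y

proposition3p6 : (X : Subset 10) →
    (IsOuterMutualVisibility Petersen X → IsIndependent Petersen X) ×
    (IsIndependent Petersen X → IsOuterMutualVisibility Petersen X)
proposition3p6 X =
  outerMutualVisibility⇒independent Petersen petersen-sym petersen-noLeaves
    petersen-triangleFree petersen-atMostOneCommonNeighbour X ,
  independent⇒outerMutualVisibility Petersen petersen-adj? petersen-diameterAtMostTwo X
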